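{- The key poset on weak compositions of length $n$ is ranked by $\mathrm{rk}$, and its covering relation is: $\mathbf{a}\prec\!\!\!\cdot\,\mathbf{b}$ if and only if $\mathbf{b}$ is obtained from $\mathbf{a}$ by incrementing a single entry $a_j$ by $1$ (so $b_j=a_j+1$ and $b_k=a_k$ for $k\ne j$) where $a_i\neq a_j+1$ for every $i<j$.
   Context: A weak composition of length $n$ is a sequence $\mathbf{a}=(a_1,\dots,a_n)$ of nonnegative integers, with rank $\mathrm{rk}(\mathbf{a})=a_1+\cdots+a_n$. The key poset is the partial order on weak compositions of length $n$ given by $\mathbf{a}\preceq\mathbf{b}$ iff $a_i\le b_i$ for all $i$ and, for all indices $1\le i<j\le n$ with $b_j>a_j$ and $a_i>a_j$, we have $b_i>b_j$. In a poset, $q$ covers $p$ ($p\prec\!\!\!\cdot\, q$) if $p\prec q$ and there is no $r$ with $p\prec r\prec q$. -}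

module Defs where

open import Data.Nat using (ℕ; zero; suc; _≤_; _<_; _+_)
open import Data.Fin using (Fin) renaming (_<_ to _<ᶠ_)
open import Data.Vec using (Vec; lookup; updateAt; sum)
open import Data.Product using (_×_; ∃-syntax)
open import Relation.Binary.PropositionalEquality using (_≡_; _≢_)
open import Relation.Nullary using (¬_)

WComp : ℕ → Set
WComp n = Vec ℕ n

rk : ∀ {n} → WComp n → ℕ
rk = sum

_≼_ : ∀ {n} → WComp n → WComp n → Set
_≼_ {n} a b =
  (∀ (i : Fin n) → lookup a i ≤ lookup b i) ×
  (∀ (i j : Fin n) → i <ᶠ j → lookup a j < lookup b j →
     lookup a j < lookup a i → lookup b j < lookup b i)

_≺_ : ∀ {n} → WComp n → WComp n → Set
a ≺ b = (a ≼ b) × (a ≢ b)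

_⋖_ : ∀ {n} → WComp n → WComp n → Set
_⋖_ {n} a b = (a ≺ b) × (¬ (∃[ c ] ((a ≺ c) × (c ≺ b))))

incr : ∀ {n} → Fin n → WComp n → WComp n
incr j a = updateAt a j suc

-- If some entry j of a has no entry equal to a_j + 1 to its left, then incrementing it
-- keeps the key condition, and since nothing lies pointwise strictly between a and
-- incr j a, this is a cover. Conversely, given a ≺ b, among the positions k with
-- a_k < b_k take the lexicographically largest (a_k, b_k, k): maximality of a_j rules
-- out an entry a_j + 1 to the left of j, and the tie-breaks on b_j and j show that
-- incr j a ≼ b. So incr j a is squeezed between a and b, and equals b when b covers a.
module Submission where

open import Defs
open import Data.Nat using (ℕ; suc; _+_; _≤_; _<_; _≤?_; _<?_)
open import Data.Nat.Properties
  using (≤-refl; ≤-antisym; ≤-<-trans; <-trans; <-irrefl; <⇒≱; 1+n≰n; n<1+n; ≤∧≢⇒<; n≤1+n;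
         m<1+n⇒m<n∨m≡n; ≰⇒>; +-suc; ≤-totalOrder; ≤-decTotalOrder)
  renaming (_≟_ to _≟ℕ_)
open import Data.Fin using (Fin; toℕ; zero; suc) renaming (_<_ to _<ᶠ_)
open import Data.Fin.Properties using (_≟_; <⇒≢; ¬∀⟶∃¬)
open import Data.Vec using (Vec; _∷_; lookup; updateAt; sum)
open import Data.Vec.Properties
  using (lookup∘updateAt; lookup∘updateAt′; tabulate∘lookup; tabulate-cong; ≡-dec)
open import Data.List using (filter; allFin)
open import Data.List.Membership.Propositional.Properties using (∈-filter⁺; ∈-allFin)
import Data.List.Relation.Unary.All as All
open import Data.List.Relation.Unary.All.Properties using (all-filter)
import Data.List.Extrema as Extrema
open import Data.Product using (_×_; _,_; proj₁; proj₂; ∃; ∃-syntax)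
open import Data.Product.Relation.Binary.Lex.NonStrict using (×-totalOrder)
open import Data.Sum using (_⊎_; inj₁; inj₂; [_,_]′)
open import Data.Empty using (⊥-elim)
open import Function using (_∘_)
open import Function.Bundles using (_⇔_; mk⇔)
open import Relation.Binary.Bundles using (TotalOrder)
open import Relation.Binary.PropositionalEquality
  using (_≡_; _≢_; _≗_; refl; sym; trans; cong; subst)
open import Relation.Nullary using (¬_; Dec; yes; no)
open import Relation.Unary using (Pred; Decidable)

≗-lookup⇒≡ : ∀ {a} {A : Set a} {n} (xs ys : Vec A n) → lookup xs ≗ lookup ys → xs ≡ ys
≗-lookup⇒≡ xs ys eq =
  trans (sym (tabulate∘lookup xs)) (trans (tabulate-cong eq) (tabulate∘lookup ys))

sum-updateAt-suc : ∀ {n} (xs : Vec ℕ n) (j : Fin n) → sum (updateAt xs j suc) ≡ suc (sum xs)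
sum-updateAt-suc (x ∷ xs) zero    = refl
sum-updateAt-suc (x ∷ xs) (suc j) = trans (cong (x +_) (sum-updateAt-suc xs j)) (+-suc x (sum xs))

module _ {b ℓ₁ ℓ₂} (O : TotalOrder b ℓ₁ ℓ₂) where
  open TotalOrder O using (Carrier) renaming (_≤_ to _⊑_)
  open Extrema O using (argmax; argmax-all; f[xs]≤f[argmax])

  argmax-Fin : ∀ {n p} {P : Pred (Fin n) p} → Decidable P → (f : Fin n → Carrier) →
               ∃ P → ∃[ j ] (P j × (∀ k → P k → f k ⊑ f j))
  argmax-Fin {n} P? f (w , Pw) =
    argmax f w candidates ,
    argmax-all f Pw (all-filter P? (allFin n)) ,
    λ k Pk → All.lookup (f[xs]≤f[argmax] w candidates) (∈-filter⁺ P? (∈-allFin k) Pk)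
    where candidates = filter P? (allFin n)

ℕ³-lex : TotalOrder _ _ _
ℕ³-lex = ×-totalOrder ≤-decTotalOrder (×-totalOrder ≤-decTotalOrder ≤-totalOrder)

_≤ₗ_ : ℕ × ℕ × ℕ → ℕ × ℕ × ℕ → Set
_≤ₗ_ = TotalOrder._≤_ ℕ³-lex

lex-≤⇒≤₁ : ∀ {x₁ x₂ x₃ y₁ y₂ y₃} → (x₁ , x₂ , x₃) ≤ₗ (y₁ , y₂ , y₃) → x₁ ≤ y₁
lex-≤⇒≤₁ (inj₁ (x₁≤y₁ , _)) = x₁≤y₁
lex-≤⇒≤₁ (inj₂ (refl , _))  = ≤-refl

lex-≤⇒<₂ : ∀ {x₁ x₂ x₃ y₁ y₂ y₃} → (x₁ , x₂ , x₃) ≤ₗ (y₁ , y₂ , y₃) →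
           x₁ ≡ y₁ → y₃ < x₃ → x₂ < y₂
lex-≤⇒<₂ (inj₁ (_ , x₁≢y₁))                x₁≡y₁ _     = ⊥-elim (x₁≢y₁ x₁≡y₁)
lex-≤⇒<₂ (inj₂ (_ , inj₁ (x₂≤y₂ , x₂≢y₂))) _     _     = ≤∧≢⇒< x₂≤y₂ x₂≢y₂
lex-≤⇒<₂ (inj₂ (_ , inj₂ (_ , x₃≤y₃)))     _     y₃<x₃ = ⊥-elim (<⇒≱ y₃<x₃ x₃≤y₃)

module _ {n : ℕ} where

  Incrementable : WComp n → Fin n → Set
  Incrementable a j = ∀ (i : Fin n) → i <ᶠ j → lookup a i ≢ suc (lookup a j)

  lookup-incr : ∀ (a : WComp n) j → lookup (incr j a) j ≡ suc (lookup a j)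
  lookup-incr a j = lookup∘updateAt j a

  lookup-incr-≢ : ∀ (a : WComp n) {i j} → i ≢ j → lookup (incr j a) i ≡ lookup a i
  lookup-incr-≢ a {i} {j} i≢j = lookup∘updateAt′ i j i≢j a

  a≢incr : ∀ (a : WComp n) j → a ≢ incr j a
  a≢incr a j a≡ = <-irrefl (trans (cong (λ v → lookup v j) a≡) (lookup-incr a j)) (n<1+n _)

  ≼-incr : ∀ {a : WComp n} {j} → Incrementable a j → a ≼ incr j a
  ≼-incr {a} {j} inc = below , condition
    where
    below : ∀ i → lookup a i ≤ lookup (incr j a) i
    below i with i ≟ j
    ... | yes refl = subst (lookup a i ≤_) (sym (lookup-incr a i)) (n≤1+n _)
    ... | no i≢j   = subst (lookup a i ≤_) (sym (lookup-incr-≢ a i≢j)) ≤-refl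

    condition : ∀ i k → i <ᶠ k → lookup a k < lookup (incr j a) k →
                lookup a k < lookup a i → lookup (incr j a) k < lookup (incr j a) i
    condition i k i<k ak<a′k ak<ai with k ≟ j
    ... | no k≢j = ⊥-elim (<-irrefl (sym (lookup-incr-≢ a k≢j)) ak<a′k)
    ... | yes refl rewrite lookup-incr a k | lookup-incr-≢ a (<⇒≢ i<k) =
          ≤∧≢⇒< ak<ai (inc i i<k ∘ sym)

  squeezed-incr : ∀ {a c : WComp n} {j} → (∀ i → lookup a i ≤ lookup c i) →
                  (∀ i → lookup c i ≤ lookup (incr j a) i) → c ≡ a ⊎ c ≡ incr j a
  squeezed-incr {a} {c} {j} a≤c c≤a′ = endpoint (lookup c j ≤? lookup a j)
    where
    off-j : ∀ i → i ≢ j → lookup c i ≡ lookup a i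
    off-j i i≢j = ≤-antisym (subst (lookup c i ≤_) (lookup-incr-≢ a i≢j) (c≤a′ i)) (a≤c i)

    agrees-with : ∀ {v} → (∀ i → i ≢ j → lookup v i ≡ lookup a i) → lookup c j ≡ lookup v j → c ≡ v
    agrees-with {v} v-off cj≡vj = ≗-lookup⇒≡ c v pointwise
      where
      pointwise : ∀ i → lookup c i ≡ lookup v i
      pointwise i with i ≟ j
      ... | yes refl = cj≡vj
      ... | no i≢j   = trans (off-j i i≢j) (sym (v-off i i≢j))

    endpoint : Dec (lookup c j ≤ lookup a j) → c ≡ a ⊎ c ≡ incr j a
    endpoint (yes cj≤aj) = inj₁ (agrees-with (λ _ _ → refl) (≤-antisym cj≤aj (a≤c j)))
    endpoint (no cj≰aj)  = inj₂ (agrees-with (λ i i≢j → lookup-incr-≢ a i≢j)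
      (≤-antisym (c≤a′ j) (subst (_≤ lookup c j) (sym (lookup-incr a j)) (≰⇒> cj≰aj))))

  ⋖-incr : ∀ {a : WComp n} {j} → Incrementable a j → a ⋖ incr j a
  ⋖-incr {a} {j} inc = (≼-incr {a} inc , a≢incr a j) , nothing-between
    where
    nothing-between : ¬ (∃[ c ] ((a ≺ c) × (c ≺ incr j a)))
    nothing-between (c , ((a≤c , _) , a≢c) , ((c≤a′ , _) , c≢a′)) =
      [ a≢c ∘ sym , c≢a′ ]′ (squeezed-incr {a} a≤c c≤a′)

  ≺⇒∃< : ∀ {a b : WComp n} → a ≺ b → ∃[ k ] (lookup a k < lookup b k)
  ≺⇒∃< {a} {b} ((a≤b , _) , a≢b)
    with ¬∀⟶∃¬ n _ (λ k → lookup a k ≟ℕ lookup b k) (a≢b ∘ ≗-lookup⇒≡ a b)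
  ... | k , ak≢bk = k , ≤∧≢⇒< (a≤b k) ak≢bk

  module _ {a b : WComp n} (a≼b : a ≼ b) {j : Fin n} (aj<bj : lookup a j < lookup b j) where

    maximal⇒Incrementable :
      (∀ i → i <ᶠ j → lookup a i < lookup b i → lookup a i ≤ lookup a j) → Incrementable a j
    maximal⇒Incrementable maximal i i<j ai≡1+aj =
      1+n≰n (subst (_≤ lookup a j) ai≡1+aj (maximal i i<j ai<bi))
      where
      bj<bi : lookup b j < lookup b i
      bj<bi = proj₂ a≼b i j i<j aj<bj (subst (lookup a j <_) (sym ai≡1+aj) (n<1+n _))
      ai<bi : lookup a i < lookup b i
      ai<bi = subst (_< lookup b i) (sym ai≡1+aj) (≤-<-trans aj<bj bj<bi)

    incr-≼ : (∀ k → j <ᶠ k → lookup a k < lookup b k → lookup a k ≡ lookup a j →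
                lookup b k < lookup b j) → incr j a ≼ b
    incr-≼ ties = below , condition
      where
      below : ∀ i → lookup (incr j a) i ≤ lookup b i
      below i with i ≟ j
      ... | yes refl = subst (_≤ lookup b i) (sym (lookup-incr a i)) aj<bj
      ... | no i≢j   = subst (_≤ lookup b i) (sym (lookup-incr-≢ a i≢j)) (proj₁ a≼b i)

      condition : ∀ i k → i <ᶠ k → lookup (incr j a) k < lookup b k →
                  lookup (incr j a) k < lookup (incr j a) i → lookup b k < lookup b i
      condition i k i<k with k ≟ j | i ≟ j
      ... | yes refl | _ rewrite lookup-incr a k | lookup-incr-≢ a (<⇒≢ i<k) =
            λ 1+ak<bk 1+ak<ai →
              proj₂ a≼b i k i<k (<-trans (n<1+n _) 1+ak<bk) (<-trans (n<1+n _) 1+ak<ai)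
      ... | no k≢j | no i≢j rewrite lookup-incr-≢ a k≢j | lookup-incr-≢ a i≢j = proj₂ a≼b i k i<k
      ... | no k≢j | yes refl rewrite lookup-incr-≢ a k≢j | lookup-incr a i =
            λ ak<bk ak<1+ai → [ proj₂ a≼b i k i<k ak<bk , ties k i<k ak<bk ]′
                                (m<1+n⇒m<n∨m≡n ak<1+ai)

  ≺⇒∃incr-≼ : ∀ {a b : WComp n} → a ≺ b → ∃[ j ] (Incrementable a j × incr j a ≼ b)
  ≺⇒∃incr-≼ {a} {b} a≺b@(a≼b , _)
    with argmax-Fin ℕ³-lex (λ k → lookup a k <? lookup b k)
                    (λ k → lookup a k , lookup b k , toℕ k) (≺⇒∃< a≺b)
  ... | j , aj<bj , maximal =
        j ,
        maximal⇒Incrementable {a} {b} a≼b {j} aj<bj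
          (λ i _ ai<bi → lex-≤⇒≤₁ (maximal i ai<bi)) ,
        incr-≼ {a} {b} a≼b {j} aj<bj
          (λ k j<k ak<bk ak≡aj → lex-≤⇒<₂ (maximal k ak<bk) ak≡aj j<k)

  ⋖⇒∃incr : ∀ {a b : WComp n} → a ⋖ b → ∃[ j ] (b ≡ incr j a × Incrementable a j)
  ⋖⇒∃incr {a} {b} (a≺b , nothing-between) with ≺⇒∃incr-≼ a≺b
  ... | j , inc , incr≼b with ≡-dec _≟ℕ_ (incr j a) b
  ...   | yes incr≡b = j , sym incr≡b , inc
  ...   | no  incr≢b = ⊥-elim (nothing-between (incr j a , proj₁ (⋖-incr inc) , incr≼b , incr≢b))

theorem2p3 : (n : ℕ) →
    ((a b : WComp n) → a ⋖ b → rk b ≡ suc (rk a)) ×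
    ((a b : WComp n) →
      (a ⋖ b) ⇔ (∃[ j ] ((b ≡ incr j a) ×
                          (∀ (i : Fin n) → i <ᶠ j → lookup a i ≢ suc (lookup a j)))))
theorem2p3 n = rk-covers , λ a b → mk⇔ ⋖⇒∃incr λ { (j , refl , inc) → ⋖-incr inc }
  where
  rk-covers : (a b : WComp n) → a ⋖ b → rk b ≡ suc (rk a)
  rk-covers a b a⋖b with ⋖⇒∃incr a⋖b
  ... | j , refl , _ = sum-updateAt-suc a j
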